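{- Let $G$ be a nontrivial profinite subgroup of $S_\infty$. If $G$ is torsion free, then $G$ does not have orbit independence.
   Context: $S_\infty$ is the group of all permutations of $\mathbb{N}$, with the topology of pointwise convergence; its profinite subgroups are exactly the closed subgroups all of whose orbits $\mathrm{orb}_G(n)=\{g(n):g\in G\}$ are finite. The orbits of a profinite $G$ are enumerated as $O_{G,0}=\mathrm{orb}_G(0)$ and $O_{G,n+1}=$ the orbit of the least natural number not in any $O_{G,m}$, $m\le n$. $H_k=\{g\restriction O_{G,k}:g\in G\}$ (a finite group). $G$ has orbit independence if $G$ is isomorphic to the Cartesian product $\prod_{k\in\mathbb{N}}H_k$. -}

module Defs where

open import Data.Nat using (ℕ; zero; suc; _≤_; _<_)
open import Data.List using (List)
open import Data.List.Membership.Propositional using (_∈_)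
open import Data.Product using (Σ; Σ-syntax; _×_; _,_; proj₁)
open import Relation.Binary.PropositionalEquality using (_≡_)
open import Relation.Nullary using (¬_)
open import Function.Bundles using (_↔_; Inverse)
open import Function.Construct.Identity using (↔-id)
open import Function.Construct.Composition using (_↔-∘_)
open import Function.Construct.Symmetry using (↔-sym)

Perm : Set
Perm = ℕ ↔ ℕ

app : Perm → ℕ → ℕ
app = Inverse.to

_≈ₚ_ : Perm → Perm → Set
g ≈ₚ h = ∀ x → app g x ≡ app h x

idP : Perm
idP = ↔-id ℕ

-- (g ∘ₚ h) x = g (h x)
_∘ₚ_ : Perm → Perm → Perm
g ∘ₚ h = g ↔-∘ h

invP : Perm → Perm
invP = ↔-sym

powP : Perm → ℕ → Perm
powP g zero    = idP
powP g (suc n) = g ∘ₚ powP g n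

SubS∞ : Set₁
SubS∞ = Perm → Set

record IsSubgroup (G : SubS∞) : Set where
  field
    respects : ∀ g h → g ≈ₚ h → G g → G h
    id∈      : G idP
    ∘∈       : ∀ g h → G g → G h → G (g ∘ₚ h)
    inv∈     : ∀ g → G g → G (invP g)

-- G is closed in the topology of pointwise convergence: any permutation
-- every basic neighbourhood {h : h ↾ n = g ↾ n} of which meets G lies in G.
IsClosed : SubS∞ → Set
IsClosed G = ∀ g → (∀ n → Σ[ h ∈ Perm ] (G h × (∀ i → i < n → app h i ≡ app g i))) → G g

InOrbit : SubS∞ → ℕ → ℕ → Set
InOrbit G m m' = Σ[ g ∈ Perm ] (G g × app g m ≡ m')

FiniteOrbits : SubS∞ → Set
FiniteOrbits G = ∀ n → Σ[ L ∈ List ℕ ] (∀ m → InOrbit G n m → m ∈ L)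

-- profinite subgroup of S∞ = closed subgroup with all orbits finite
record IsProfinite (G : SubS∞) : Set where
  field
    subgroup : IsSubgroup G
    closed   : IsClosed G
    finOrb   : FiniteOrbits G

Nontrivial : SubS∞ → Set
Nontrivial G = Σ[ g ∈ Perm ] (G g × ¬ (g ≈ₚ idP))

TorsionFree : SubS∞ → Set
TorsionFree G = ∀ g → G g → ¬ (g ≈ₚ idP) → ∀ n → ¬ (powP g (suc n) ≈ₚ idP)

-- Enumeration of orbits.  r k is the chosen representative of O_{G,k}:
-- r 0 = 0 and r (k+1) is the least natural number in none of the
-- orbits O_{G,m} = orb_G(r m), m ≤ k.  Then O_{G,k} = orb_G(r k).

IsOrbitEnumeration : SubS∞ → (ℕ → ℕ) → Set
IsOrbitEnumeration G r =
  (r 0 ≡ 0) ×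
  (∀ k → (∀ m → m ≤ k → ¬ InOrbit G (r m) (r (suc k)))
       × (∀ j → j < r (suc k) → Σ[ m ∈ ℕ ] (m ≤ k × InOrbit G (r m) j)))

El : SubS∞ → Set
El G = Σ[ g ∈ Perm ] G g

-- H_k = {g ↾ O_{G,k} : g ∈ G}: represented by elements of G, two being
-- equal in H_k iff they agree on O_{G,k}.
_≈[_,_,_]_ : {G : SubS∞} → El G → SubS∞ → (ℕ → ℕ) → ℕ → El G → Set
a ≈[ G , r , k ] b = ∀ n → InOrbit G (r k) n → app (proj₁ a) n ≡ app (proj₁ b) n

ProdEl : SubS∞ → Set
ProdEl G = ℕ → El G

_≈Π[_,_]_ : {G : SubS∞} → ProdEl G → SubS∞ → (ℕ → ℕ) → ProdEl G → Set
x ≈Π[ G , r ] y = ∀ k → x k ≈[ G , r , k ] y k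

mulEl : (G : SubS∞) → IsSubgroup G → El G → El G → El G
mulEl G sg (g , p) (h , q) = (g ∘ₚ h) , IsSubgroup.∘∈ sg g h p q

-- Isomorphism of topological groups G ≅ ∏_k H_k (H_k discrete, product
-- topology on ∏ H_k, pointwise-convergence topology on G).
record TopIso (G : SubS∞) (sg : IsSubgroup G) (r : ℕ → ℕ) : Set where
  field
    φ : El G → ProdEl G
    ψ : ProdEl G → El G
    φ-cong : ∀ a b → proj₁ a ≈ₚ proj₁ b → φ a ≈Π[ G , r ] φ b
    ψ-cong : ∀ x y → x ≈Π[ G , r ] y → proj₁ (ψ x) ≈ₚ proj₁ (ψ y)
    φ-hom  : ∀ a b → φ (mulEl G sg a b) ≈Π[ G , r ] (λ k → mulEl G sg (φ a k) (φ b k))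
    ψφ     : ∀ a → proj₁ (ψ (φ a)) ≈ₚ proj₁ a
    φψ     : ∀ x → φ (ψ x) ≈Π[ G , r ] x
    φ-cont : ∀ a k → Σ[ n ∈ ℕ ] (∀ b → (∀ i → i < n → app (proj₁ b) i ≡ app (proj₁ a) i)
                                      → φ b k ≈[ G , r , k ] φ a k)
    ψ-cont : ∀ x m → Σ[ K ∈ ℕ ] (∀ y → (∀ k → k < K → y k ≈[ G , r , k ] x k)
                                      → app (proj₁ (ψ y)) m ≡ app (proj₁ (ψ x)) m)

OrbitIndependence : (G : SubS∞) → IsSubgroup G → Set
OrbitIndependence G sg = Σ[ r ∈ (ℕ → ℕ) ] (IsOrbitEnumeration G r × TopIso G sg r)

{-# OPTIONS --safe #-}
module Submission where

-- If G ≅ ∏ H_k, pick g ∈ G moving some point of an orbit O_{G,k}.  The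
-- element of ∏ H_k whose k-th coordinate is that of g and whose other
-- coordinates are trivial has finite order: by pigeonhole, every element
-- of G acts on a finite orbit of at most N points with order dividing N!.
-- Its preimage in G is then a nontrivial element of finite order.

open import Data.Fin as Fin using (Fin; toℕ)
open import Data.Fin.Properties using (pigeonhole; toℕ<n)
open import Data.List using (List; length; lookup)
open import Data.List.Membership.Propositional using (_∈_)
open import Data.List.Relation.Unary.Any using (index)
open import Data.List.Relation.Unary.Any.Properties using (lookup-index)
open import Data.Nat using (ℕ; zero; suc; _+_; _*_; _∸_; _≤_; _<_; _!; NonZero; _≟_)
open import Data.Nat.Divisibility using (_∣_; ∣-trans; m∣m*n; m≤n⇒m!∣n!)
open import Data.Nat.Properties
  using (n<1+n; m+[n∸m]≡n; <⇒≤; m<n⇒0<n∸m; m∸n≤m; ≤-trans; ≤-pred; _!≢0)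
open import Data.Product using (∃-syntax; ∃₂; _×_; _,_; proj₁; proj₂)
open import Function.Bundles using (Injection)
open import Function.Properties.Inverse using (↔⇒↣)
open import Relation.Binary.PropositionalEquality
  using (_≡_; refl; sym; trans; cong; module ≡-Reasoning)
open import Relation.Binary.Bundles using (Setoid)
import Relation.Binary.Reasoning.Setoid as SetoidReasoning
open import Relation.Nullary using (¬_; yes; no; contradiction)
open import Relation.Nullary.Decidable using (decidable-stable)

open import Defs

n∣n! : ∀ {n} → 0 < n → n ∣ n !
n∣n! {suc n} _ = m∣m*n (n !)

app-injective : (g : Perm) → ∀ {x y} → app g x ≡ app g y → x ≡ y
app-injective g = Injection.injective (↔⇒↣ g)

powP-idP : ∀ m x → app (powP idP m) x ≡ x
powP-idP zero    x = refl
powP-idP (suc m) x = powP-idP m x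

module _ (a : Perm) where
  open ≡-Reasoning

  powP-+ : ∀ p q x → app (powP a (p + q)) x ≡ app (powP a p) (app (powP a q) x)
  powP-+ zero    q x = refl
  powP-+ (suc p) q x = cong (app a) (powP-+ p q x)

  powP-*-fixes : ∀ {d x} → app (powP a d) x ≡ x → ∀ q → app (powP a (q * d)) x ≡ x
  powP-*-fixes         fix zero    = refl
  powP-*-fixes {d} {x} fix (suc q) = begin
    app (powP a (d + q * d)) x              ≡⟨ powP-+ d (q * d) x ⟩
    app (powP a d) (app (powP a (q * d)) x) ≡⟨ cong (app (powP a d)) (powP-*-fixes fix q) ⟩
    app (powP a d) x                        ≡⟨ fix ⟩
    x                                       ∎

  powP-return : (L : List ℕ) (x : ℕ) → (∀ i → app (powP a i) x ∈ L)
              → ∃[ d ] (0 < d × d ≤ length L × app (powP a d) x ≡ x)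
  powP-return L x iterates∈L = from-collision (pigeonhole (n<1+n (length L)) slot)
    where
    slot : Fin (suc (length L)) → Fin (length L)
    slot i = index (iterates∈L (toℕ i))

    from-collision : ∃₂ (λ i j → i Fin.< j × slot i ≡ slot j)
                   → ∃[ d ] (0 < d × d ≤ length L × app (powP a d) x ≡ x)
    from-collision (i , j , i<j , same-slot) =
      toℕ j ∸ toℕ i , m<n⇒0<n∸m i<j , ≤-trans (m∸n≤m (toℕ j) (toℕ i)) (≤-pred (toℕ<n j)) ,
      app-injective (powP a (toℕ i)) (begin
        app (powP a (toℕ i)) (app (powP a (toℕ j ∸ toℕ i)) x)
          ≡⟨ powP-+ (toℕ i) (toℕ j ∸ toℕ i) x ⟨
        app (powP a (toℕ i + (toℕ j ∸ toℕ i))) x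
          ≡⟨ cong (λ e → app (powP a e) x) (m+[n∸m]≡n (<⇒≤ i<j)) ⟩
        app (powP a (toℕ j)) x
          ≡⟨ lookup-index (iterates∈L (toℕ j)) ⟩
        lookup L (slot j)
          ≡⟨ cong (lookup L) same-slot ⟨
        lookup L (slot i)
          ≡⟨ lookup-index (iterates∈L (toℕ i)) ⟨
        app (powP a (toℕ i)) x ∎)

  powP-length!-fixes : (L : List ℕ) (x : ℕ) → (∀ i → app (powP a i) x ∈ L)
                     → app (powP a (length L !)) x ≡ x
  powP-length!-fixes L x iterates∈L with powP-return L x iterates∈L
  ... | d , 0<d , d≤L , fix = begin
    app (powP a (length L !)) x                    ≡⟨ cong (λ e → app (powP a e) x) (_∣_.equality d∣L!) ⟩
    app (powP a (_∣_.quotient d∣L! * d)) x         ≡⟨ powP-*-fixes fix (_∣_.quotient d∣L!) ⟩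
    x                                              ∎
    where
    d∣L! : d ∣ length L !
    d∣L! = ∣-trans (n∣n! 0<d) (m≤n⇒m!∣n! d≤L)

module _ {G : SubS∞} (sg : IsSubgroup G) where
  open IsSubgroup sg

  powP∈ : ∀ {g} → G g → ∀ n → G (powP g n)
  powP∈ g∈G zero    = id∈
  powP∈ g∈G (suc n) = ∘∈ _ _ g∈G (powP∈ g∈G n)

  InOrbit-act : ∀ {a c n} → G a → InOrbit G c n → InOrbit G c (app a n)
  InOrbit-act {a} a∈G (h , h∈G , hc≡n) = a ∘ₚ h , ∘∈ a h a∈G h∈G , cong (app a) hc≡n

  orbitBound : FiniteOrbits G → ℕ → ℕ
  orbitBound finOrb c = length (proj₁ (finOrb c))

  powP-orbitBound!-fixes : (finOrb : FiniteOrbits G) → ∀ {a c n} → G a → InOrbit G c n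
                         → app (powP a (orbitBound finOrb c !)) n ≡ n
  powP-orbitBound!-fixes finOrb a∈G n∈orb =
    powP-length!-fixes _ _ _
      (λ i → proj₂ (finOrb _) _ (InOrbit-act (powP∈ a∈G i) n∈orb))

  idEl : El G
  idEl = idP , id∈

  powEl : El G → ℕ → El G
  powEl (g , g∈G) n = powP g n , powP∈ g∈G n

TorsionFree⇒¬powP≈id : ∀ {G g} → TorsionFree G → G g → ¬ (g ≈ₚ idP)
                     → ∀ e → .{{NonZero e}} → ¬ (powP g e ≈ₚ idP)
TorsionFree⇒¬powP≈id tf g∈G g≉id (suc e) = tf _ g∈G g≉id e

module Orbitwise {G : SubS∞} (sg : IsSubgroup G) (r : ℕ → ℕ) where

  onOrbit : ℕ → Setoid _ _
  onOrbit k = record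
    { Carrier       = El G
    ; _≈_           = λ a b → a ≈[ G , r , k ] b
    ; isEquivalence = record
      { refl  = λ _ _ → refl
      ; sym   = λ a≈b n n∈orb → sym (a≈b n n∈orb)
      ; trans = λ a≈b b≈c n n∈orb → trans (a≈b n n∈orb) (b≈c n n∈orb)
      }
    }

  module OnOrbit (k : ℕ) where
    open Setoid (onOrbit k) public using () renaming (refl to ≈-refl)
    open SetoidReasoning (onOrbit k) public

  FixesOrbit : El G → ℕ → Set
  FixesOrbit a k = a ≈[ G , r , k ] idEl sg

  mulEl-cong : ∀ {k} a a′ b b′ → a ≈[ G , r , k ] a′ → b ≈[ G , r , k ] b′
             → mulEl G sg a b ≈[ G , r , k ] mulEl G sg a′ b′
  mulEl-cong _ a′ b _ a≈a′ b≈b′ n n∈orb =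
    trans (a≈a′ _ (InOrbit-act sg (proj₂ b) n∈orb)) (cong (app (proj₁ a′)) (b≈b′ n n∈orb))

  powEl-cong : ∀ {k} a b → a ≈[ G , r , k ] b → ∀ m → powEl sg a m ≈[ G , r , k ] powEl sg b m
  powEl-cong a b a≈b zero    n n∈orb = refl
  powEl-cong a b a≈b (suc m) =
    mulEl-cong a b (powEl sg a m) (powEl sg b m) a≈b (powEl-cong a b a≈b m)

module TopIsoProperties {G : SubS∞} {sg : IsSubgroup G} {r : ℕ → ℕ} (T : TopIso G sg r) where
  open TopIso T
  open Orbitwise sg r

  φ-idEl : ∀ k → FixesOrbit (φ (idEl sg) k) k
  φ-idEl k n n∈orb = sym (app-injective (proj₁ (φ (idEl sg) k))
    (trans (φ-cong (idEl sg) (mulEl G sg (idEl sg) (idEl sg)) (λ _ → refl) k n n∈orb)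
           (φ-hom (idEl sg) (idEl sg) k n n∈orb)))

  φ-powEl : ∀ a m k → φ (powEl sg a m) k ≈[ G , r , k ] powEl sg (φ a k) m
  φ-powEl a zero    k = φ-idEl k
  φ-powEl a (suc m) k = begin
    φ (mulEl G sg a (powEl sg a m)) k
      ≈⟨ φ-hom a (powEl sg a m) k ⟩
    mulEl G sg (φ a k) (φ (powEl sg a m) k)
      ≈⟨ mulEl-cong (φ a k) (φ a k) (φ (powEl sg a m) k) (powEl sg (φ a k) m)
                    (≈-refl {φ a k}) (φ-powEl a m k) ⟩
    mulEl G sg (φ a k) (powEl sg (φ a k) m) ∎
    where open OnOrbit k

  φ-fixes⇒≈id : ∀ a → (∀ k → FixesOrbit (φ a k) k) → proj₁ a ≈ₚ idP
  φ-fixes⇒≈id a φa-fixes x = begin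
    app (proj₁ a) x                    ≡⟨ ψφ a x ⟨
    app (proj₁ (ψ (φ a))) x            ≡⟨ ψ-cong (φ a) (φ (idEl sg)) φa≈φid x ⟩
    app (proj₁ (ψ (φ (idEl sg)))) x    ≡⟨ ψφ (idEl sg) x ⟩
    x                                  ∎
    where
    open ≡-Reasoning
    φa≈φid : φ a ≈Π[ G , r ] φ (idEl sg)
    φa≈φid k n n∈orb = trans (φa-fixes k n n∈orb) (sym (φ-idEl k n n∈orb))

  single : ℕ → El G → ProdEl G
  single k z j with j ≟ k
  ... | yes _ = z
  ... | no  _ = idEl sg

  single-at : ∀ k z → single k z k ≡ z
  single-at k z with k ≟ k
  ... | yes _   = refl
  ... | no  k≢k = contradiction refl k≢k

  ψ-single≉id : ∀ {k z} → ¬ FixesOrbit z k → ¬ (proj₁ (ψ (single k z)) ≈ₚ idP)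
  ψ-single≉id {k} {z} z-moves ψs≈id = z-moves (begin
    z                        ≡⟨ single-at k z ⟨
    single k z k             ≈⟨ φψ (single k z) k ⟨
    φ (ψ (single k z)) k     ≈⟨ φ-cong (ψ (single k z)) (idEl sg) ψs≈id k ⟩
    φ (idEl sg) k            ≈⟨ φ-idEl k ⟩
    idEl sg                  ∎)
    where open OnOrbit k

  powP-ψ-single≈id : (finOrb : FiniteOrbits G) → ∀ k z
                   → powP (proj₁ (ψ (single k z))) (orbitBound sg finOrb (r k) !) ≈ₚ idP
  powP-ψ-single≈id finOrb k z = φ-fixes⇒≈id (powEl sg h e) λ j → let open OnOrbit j in begin
    φ (powEl sg h e) j        ≈⟨ φ-powEl h e j ⟩
    powEl sg (φ h j) e        ≈⟨ powEl-cong (φ h j) (single k z j) (φψ (single k z) j) e ⟩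
    powEl sg (single k z j) e ≈⟨ single-pow-fixes j ⟩
    idEl sg                   ∎
    where
    h : El G
    h = ψ (single k z)

    e : ℕ
    e = orbitBound sg finOrb (r k) !

    single-pow-fixes : ∀ j → FixesOrbit (powEl sg (single k z j) e) j
    single-pow-fixes j with j ≟ k
    ... | yes refl = λ _ → powP-orbitBound!-fixes sg finOrb (proj₂ z)
    ... | no  _    = λ n _ → powP-idP e n

  TorsionFree⇒φ-fixes : FiniteOrbits G → TorsionFree G → ∀ a k → FixesOrbit (φ a k) k
  TorsionFree⇒φ-fixes finOrb tf a k n n∈orb =
    decidable-stable (app (proj₁ (φ a k)) n ≟ n) λ moves-n →
      TorsionFree⇒¬powP≈id tf (proj₂ (ψ (single k (φ a k))))
        (ψ-single≉id (λ fixes → moves-n (fixes n n∈orb)))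
        (orbitBound sg finOrb (r k) !) {{orbitBound sg finOrb (r k) !≢0}}
        (powP-ψ-single≈id finOrb k (φ a k))

proposition4 : (G : SubS∞) (pf : IsProfinite G) → Nontrivial G → TorsionFree G
               → ¬ OrbitIndependence G (IsProfinite.subgroup pf)
proposition4 G pf (g , g∈G , g≉id) tf (r , _ , T) =
  g≉id (φ-fixes⇒≈id (g , g∈G) (TorsionFree⇒φ-fixes (IsProfinite.finOrb pf) tf (g , g∈G)))
  where open TopIsoProperties T
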